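{- For every $n\ge1$ there exists a bijection $\psi$ from the set $\mathcal{S}_n$ of snakes of length $n$ onto the set $\mathfrak{R}_n$ of rc-invariant alternating permutations of length $2n$. In particular $|\mathcal{S}_n|=|\mathfrak{R}_n|$.
   Context: A signed permutation of length $n$ is a word $p_1\cdots p_n$ with $p_i=\pm\rho_i$ for some permutation $\rho$ of $[n]$. A snake of length $n$ is a signed permutation $p$ with $p_1>0$ and $p_1>p_2<p_3>p_4<\cdots$. A permutation $\pi$ of $[2n]$ is alternating if $\pi_1>\pi_2<\pi_3>\cdots$, and rc-invariant if $\pi_i+\pi_{2n+1-i}=2n+1$ for all $i$ (i.e. it equals its reverse-complement). -}

module Defs where

open import Data.Bool using (Bool; true; false; _∧_; T; not)
open import Data.Nat as ℕ using (ℕ; zero; suc; _+_; _*_)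
open import Data.Integer as ℤ using (ℤ; +_; -_; ∣_∣)
open import Data.List using (List; []; _∷_; zipWith)
open import Data.Vec as V using (Vec; toList; reverse)
open import Data.Product using (Σ)
open import Relation.Nullary.Decidable using (⌊_⌋)

all : {A : Set} → (A → Bool) → List A → Bool
all p []       = true
all p (x ∷ xs) = p x ∧ all p xs

-- Boolean checks (so that membership proofs  T (...)  are proof-irrelevant
-- and the sets below have the intended equality: equality of the words).

inRange : ℕ → List ℕ → Bool
inRange n = all (λ k → ⌊ 1 ℕ.≤? k ⌋ ∧ ⌊ k ℕ.≤? n ⌋)

distinct : List ℕ → Bool
distinct []       = true
distinct (x ∷ xs) = all (λ y → not ⌊ x ℕ.≟ y ⌋) xs ∧ distinct xs

isPerm : (n : ℕ) → Vec ℕ n → Bool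
isPerm n w = inRange n (toList w) ∧ distinct (toList w)

-- signed permutation: p_i = ±ρ_i with ρ a permutation of [n]
isSignedPerm : (n : ℕ) → Vec ℤ n → Bool
isSignedPerm n p = isPerm n (V.map ∣_∣ p)

-- alternating condition  w₁ > w₂ < w₃ > w₄ < ⋯  (first comparison is '>')
-- altDown xs : x₁ > x₂ < x₃ > ⋯ ; altUp xs : x₁ < x₂ > x₃ < ⋯
module _ {A : Set} (_<?_ : A → A → Bool) where
  altDown altUp : List A → Bool
  altDown []           = true
  altDown (x ∷ [])     = true
  altDown (x ∷ y ∷ ys) = (y <? x) ∧ altUp (y ∷ ys)
  altUp []           = true
  altUp (x ∷ [])     = true
  altUp (x ∷ y ∷ ys) = (x <? y) ∧ altDown (y ∷ ys)

_<ℤ?_ : ℤ → ℤ → Bool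
x <ℤ? y = ⌊ x ℤ.<? y ⌋

_<ℕ?_ : ℕ → ℕ → Bool
x <ℕ? y = ⌊ x ℕ.<? y ⌋

headPos : {n : ℕ} → Vec ℤ n → Bool
headPos V.[] = true
headPos (x V.∷ _) = ⌊ (+ 0) ℤ.<? x ⌋

isSnake : (n : ℕ) → Vec ℤ n → Bool
isSnake n p = isSignedPerm n p ∧ headPos p ∧ altDown _<ℤ?_ (toList p)

isRC : (n : ℕ) → Vec ℕ (2 * n) → Bool
isRC n π = all (λ b → b) (zipWith (λ a b → ⌊ a + b ℕ.≟ suc (2 * n) ⌋)
                                          (toList π) (toList (reverse π)))

isRCAlt : (n : ℕ) → Vec ℕ (2 * n) → Bool
isRCAlt n π = isPerm (2 * n) π ∧ altDown _<ℕ?_ (toList π) ∧ isRC n π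

Snakes : ℕ → Set
Snakes n = Σ (Vec ℤ n) (λ p → T (isSnake n p))

RCAlt : ℕ → Set
RCAlt n = Σ (Vec ℕ (2 * n)) (λ π → T (isRCAlt n π))

-- Write ±[n] = {−n, …, −1, 1, …, n}. The order isomorphism rank : ±[n] → [2n] turns negation
-- into the complement b ↦ 2n + 1 − b. A snake p is sent to π = reverse (compl B) ++ B, where
-- B = rank ((−1)ⁿ p), so π is rc-invariant by construction. Since the |pᵢ| are distinct, B and
-- its complement partition [2n], so π is a permutation. Since rank is monotone, the sign (−1)ⁿ
-- makes B alternate as the right half of an alternating word of length 2n must, and the
-- comparison πₙ = 2n + 1 − b₁ against πₙ₊₁ = b₁ at the junction goes the right way exactly when
-- p₁ > 0. Conversely an rc-invariant word is the mirror of its right half B, and reading the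
-- same equivalences backwards shows that B encodes a snake.
module Submission where

open import Defs

open import Data.Bool using (Bool; true; false; _∧_; T; not)
open import Data.Bool.Properties
  using (T-∧; T-irrelevant; not-involutive; ∧-assoc; ∧-comm; ∧-idem; ∧-identityʳ)
open import Data.Empty using (⊥-elim)
open import Data.Integer as ℤ using (ℤ; +_; -[1+_]; -_; ∣_∣; +<+; -<+; -<-)
import Data.Integer.Properties as ℤ
open import Data.List using (List; []; _∷_; _++_; _∷ʳ_; map; reverse; length; zipWith)
import Data.List.Properties as List
open import Data.List.Membership.Propositional using (_∈_)
open import Data.List.Membership.Propositional.Properties using (∈-map⁻; ∈-map⁺; ∈-++⁺ʳ)
open import Data.List.Relation.Binary.Disjoint.Propositional using (Disjoint)
open import Data.List.Relation.Unary.All as All using (All; []; _∷_)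
import Data.List.Relation.Unary.All.Properties as AllP
open import Data.List.Relation.Unary.AllPairs using ([]; _∷_)
open import Data.List.Relation.Unary.Any using (here; there)
open import Data.List.Relation.Unary.Unique.Propositional using (Unique)
import Data.List.Relation.Unary.Unique.Propositional.Properties as Unique
open import Data.Nat as ℕ using (ℕ; zero; suc; _+_; _*_; _∸_; _≤_; _≥_; z≤n; s≤s)
open import Data.Nat.GeneralisedArithmetic using (iterate)
open import Data.Nat.Properties
open import Data.Product using (Σ; _×_; _,_; proj₁; proj₂)
open import Data.Product.Function.NonDependent.Propositional using (_×-⇔_)
open import Data.Sum using (_⊎_; inj₁; inj₂)
open import Data.Unit using (⊤; tt)
open import Data.Vec as V using (Vec; toList)
import Data.Vec.Properties as VP
open import Function using (id; _∘_; flip; _⇔_; mk⇔; Equivalence; _⤖_; mk↔ₛ′)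
open import Function.Properties.Equivalence using () renaming (trans to ⇔-trans; sym to ⇔-sym)
open import Function.Properties.Inverse using (↔⇒⤖)
open import Relation.Binary.PropositionalEquality
open import Relation.Nullary.Decidable
  using (Dec; yes; no; ⌊_⌋; does-⇔; isYes≗does; toWitness; fromWitness; toWitnessFalse; fromWitnessFalse)

open import Data.List.Relation.Binary.Permutation.Setoid (setoid ℕ) using (_↭_; ↭-trans; ↭-sym)
import Data.List.Relation.Binary.Permutation.Setoid.Properties (setoid ℕ) as ↭

open Equivalence using (to; from)

private variable
  A C : Set

⌊⌋-⇔ : (a? : Dec A) (b? : Dec C) → A ⇔ C → ⌊ a? ⌋ ≡ ⌊ b? ⌋
⌊⌋-⇔ a? b? a⇔b = trans (isYes≗does a?) (trans (does-⇔ a⇔b a? b?) (sym (isYes≗does b?)))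

T-⌊⌋ : {a? : Dec A} → T ⌊ a? ⌋ ⇔ A
T-⌊⌋ = mk⇔ toWitness fromWitness

T-all : ∀ {p : A → Bool} xs → T (all p xs) ⇔ All (T ∘ p) xs
T-all []       = mk⇔ (λ _ → []) (λ _ → tt)
T-all (x ∷ xs) = mk⇔ (λ t → let px , pxs = to T-∧ t in px ∷ to (T-all xs) pxs)
                     (λ where (px ∷ pxs) → from T-∧ (px , from (T-all xs) pxs))

_∈[1,_] : ℕ → ℕ → Set
k ∈[1, n ] = 1 ≤ k × k ≤ n

T-inRange : ∀ n xs → T (inRange n xs) ⇔ All (_∈[1, n ]) xs
T-inRange n xs = mk⇔ (All.map (to bounds) ∘ to (T-all xs)) (from (T-all xs) ∘ All.map (from bounds))
  where
  bounds : ∀ {k} → T (⌊ 1 ℕ.≤? k ⌋ ∧ ⌊ k ℕ.≤? n ⌋) ⇔ k ∈[1, n ]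
  bounds {k} = ⇔-trans T-∧ (T-⌊⌋ {a? = 1 ℕ.≤? k} ×-⇔ T-⌊⌋ {a? = k ℕ.≤? n})

T-distinct : ∀ xs → T (distinct xs) ⇔ Unique xs
T-distinct []       = mk⇔ (λ _ → []) (λ _ → tt)
T-distinct (x ∷ xs) = mk⇔
  (λ t → let x∉ , u = to T-∧ t in All.map toWitnessFalse (to (T-all xs) x∉) ∷ to (T-distinct xs) u)
  (λ where (x∉ ∷ u) → from T-∧ (from (T-all xs) (All.map fromWitnessFalse x∉) , from (T-distinct xs) u))

Σ-T-≡ : ∀ {P : A → Bool} {x y : A} {p : T (P x)} {q : T (P y)} → x ≡ y → (x , p) ≡ (y , q)
Σ-T-≡ refl = cong (_ ,_) (T-irrelevant _ _)

restrict-⤖ : {P : A → Bool} {Q : C → Bool} (f : A → C) (g : C → A) →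
             (∀ x → T (P x) → T (Q (f x))) → (∀ y → T (Q y) → T (P (g y))) →
             (∀ y → T (Q y) → f (g y) ≡ y) → (∀ x → T (P x) → g (f x) ≡ x) →
             Σ A (T ∘ P) ⤖ Σ C (T ∘ Q)
restrict-⤖ f g f-closed g-closed fg gf =
  ↔⇒⤖ (mk↔ₛ′ (λ (x , p) → f x , f-closed x p) (λ (y , q) → g y , g-closed y q)
              (λ (y , q) → Σ-T-≡ (fg y q)) (λ (x , p) → Σ-T-≡ (gf x p)))

++-injective : ∀ {xs ys zs ws : List A} → length xs ≡ length ys →
               xs ++ zs ≡ ys ++ ws → xs ≡ ys × zs ≡ ws
++-injective {xs = []}     {[]}     _   e = refl , e
++-injective {xs = x ∷ xs} {y ∷ ys} len e
  with ++-injective {xs = xs} {ys} (suc-injective len) (List.∷-injectiveʳ e)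
... | refl , zs≡ws = cong (_∷ xs) (List.∷-injectiveˡ e) , zs≡ws

Unique-map⁺-local : ∀ {f : A → C} {xs} → (∀ {x y} → x ∈ xs → y ∈ xs → f x ≡ f y → x ≡ y) →
                    Unique xs → Unique (map f xs)
Unique-map⁺-local {xs = []}     _   []         = []
Unique-map⁺-local {xs = x ∷ xs} inj (x∉xs ∷ u) =
  AllP.map⁺ (All.tabulate (λ y∈xs fx≡fy → All.lookup x∉xs y∈xs (inj (here refl) (there y∈xs) fx≡fy)))
  ∷ Unique-map⁺-local (λ x∈ y∈ → inj (there x∈) (there y∈)) u

Unique-map⇒injective : ∀ {f : A → C} {xs x y} → Unique (map f xs) →
                       x ∈ xs → y ∈ xs → f x ≡ f y → x ≡ y
Unique-map⇒injective         {xs = _ ∷ _} _         (here refl) (here refl) _ = refl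
Unique-map⇒injective {f = f} {xs = _ ∷ _} (fx∉ ∷ _) (here refl) (there y∈)  e =
  ⊥-elim (All.lookup fx∉ (∈-map⁺ f y∈) e)
Unique-map⇒injective {f = f} {xs = _ ∷ _} (fy∉ ∷ _) (there x∈)  (here refl) e =
  ⊥-elim (All.lookup fy∉ (∈-map⁺ f x∈) (sym e))
Unique-map⇒injective         {xs = _ ∷ _} (_ ∷ u)   (there x∈)  (there y∈)  e =
  Unique-map⇒injective u x∈ y∈ e

Unique-map⇔ : ∀ {f : A → C} {xs} → (∀ {x y} → x ∈ xs → y ∈ xs → f x ≡ f y → x ≡ y) →
              Unique (map f xs) ⇔ Unique xs
Unique-map⇔ inj = mk⇔ Unique.map⁻ (Unique-map⁺-local inj)

Unique-++⁻ : ∀ xs {ys : List A} → Unique (xs ++ ys) → Unique xs × Unique ys × Disjoint xs ys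
Unique-++⁻ []       u = [] , u , λ ()
Unique-++⁻ (x ∷ xs) (x∉ ∷ u) with Unique-++⁻ xs u
... | uxs , uys , disjoint = AllP.++⁻ˡ xs x∉ ∷ uxs , uys , λ where
  (here refl  , x∈ys) → All.lookup x∉ (∈-++⁺ʳ xs x∈ys) refl
  (there v∈xs , v∈ys) → disjoint (v∈xs , v∈ys)

-- Alternating words

step : (A → A → Bool) → Bool → A → A → Bool
step R true  x y = R y x
step R false x y = R x y

Alt : (A → A → Bool) → Bool → List A → Bool
Alt R down []           = true
Alt R down (x ∷ [])     = true
Alt R down (x ∷ y ∷ ys) = step R down x y ∧ Alt R (not down) (y ∷ ys)

altDown≡Alt : ∀ (R : A → A → Bool) xs → altDown R xs ≡ Alt R true xs
altUp≡Alt   : ∀ (R : A → A → Bool) xs → altUp R xs ≡ Alt R false xs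
altDown≡Alt R []           = refl
altDown≡Alt R (x ∷ [])     = refl
altDown≡Alt R (x ∷ y ∷ ys) = cong (R y x ∧_) (altUp≡Alt R (y ∷ ys))
altUp≡Alt   R []           = refl
altUp≡Alt   R (x ∷ [])     = refl
altUp≡Alt   R (x ∷ y ∷ ys) = cong (R x y ∧_) (altDown≡Alt R (y ∷ ys))

iterate-not-suc : ∀ b k → iterate not b (suc k) ≡ not (iterate not b k)
iterate-not-suc b zero    = refl
iterate-not-suc b (suc k) = iterate-not-suc (not b) k

step-swap : ∀ (R : A → A → Bool) b x y → step R b y x ≡ step R (not b) x y
step-swap R true  x y = refl
step-swap R false x y = refl

step-flip : ∀ (R : A → A → Bool) b x y → step (flip R) b x y ≡ step R (not b) x y
step-flip R true  x y = refl
step-flip R false x y = refl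

step-map : ∀ {R : A → A → Bool} {S : C → C → Bool} {f : A → C} b {x y} →
           S (f x) (f y) ≡ R x y → S (f y) (f x) ≡ R y x → step S b (f x) (f y) ≡ step R b x y
step-map true  _ e = e
step-map false e _ = e

Alt-flip : ∀ (R : A → A → Bool) b xs → Alt (flip R) b xs ≡ Alt R (not b) xs
Alt-flip R b []           = refl
Alt-flip R b (x ∷ [])     = refl
Alt-flip R b (x ∷ y ∷ ys) = cong₂ _∧_ (step-flip R b x y) (Alt-flip R (not b) (y ∷ ys))

Alt-map : ∀ {R : A → A → Bool} {S : C → C → Bool} {f : A → C} {P : A → Set} →
          (∀ {x y} → P x → P y → S (f x) (f y) ≡ R x y) →
          ∀ b {xs} → All P xs → Alt S b (map f xs) ≡ Alt R b xs
Alt-map mono b []              = refl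
Alt-map mono b (_ ∷ [])        = refl
Alt-map mono b (px ∷ py ∷ pys) =
  cong₂ _∧_ (step-map b (mono px py) (mono py px)) (Alt-map mono (not b) (py ∷ pys))

Alt-++ : ∀ (R : A → A → Bool) b xs y ys →
         Alt R b (xs ++ y ∷ ys) ≡ Alt R b (xs ∷ʳ y) ∧ Alt R (iterate not b (length xs)) (y ∷ ys)
Alt-++ R b []            y ys = refl
Alt-++ R b (x ∷ [])      y ys = cong (_∧ Alt R (not b) (y ∷ ys)) (sym (∧-identityʳ _))
Alt-++ R b (x ∷ x′ ∷ xs) y ys =
  trans (cong (step R b x x′ ∧_) (Alt-++ R (not b) (x′ ∷ xs) y ys)) (sym (∧-assoc (step R b x x′) _ _))

Alt-reverse : ∀ (R : A → A → Bool) b xs → Alt R b (reverse xs) ≡ Alt R (iterate not b (suc (length xs))) xs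
Alt-reverse R b []           = refl
Alt-reverse R b (x ∷ [])     = refl
Alt-reverse R b (x ∷ y ∷ ys) = begin
  Alt R b (reverse (x ∷ y ∷ ys))
    ≡⟨ cong (Alt R b) reverse-∷∷ ⟩
  Alt R b (reverse ys ++ y ∷ x ∷ [])
    ≡⟨ Alt-++ R b (reverse ys) y (x ∷ []) ⟩
  Alt R b (reverse ys ∷ʳ y) ∧ (step R c y x ∧ true)
    ≡⟨ cong₂ _∧_ (trans (cong (Alt R b) (sym (List.unfold-reverse y ys))) (Alt-reverse R b (y ∷ ys)))
                 (∧-identityʳ _) ⟩
  Alt R (iterate not b (2 + k)) (y ∷ ys) ∧ step R c y x
    ≡⟨ ∧-comm _ (step R c y x) ⟩
  step R c y x ∧ Alt R (iterate not b (2 + k)) (y ∷ ys)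
    ≡⟨ cong₂ _∧_ (trans (step-swap R c x y) (cong (λ d → step R d x y) direction-xy))
                 (cong (λ d → Alt R d (y ∷ ys)) direction-y) ⟩
  Alt R (iterate not b (3 + k)) (x ∷ y ∷ ys) ∎
  where
  open ≡-Reasoning
  k = length ys
  c = iterate not b (length (reverse ys))
  reverse-∷∷ : reverse (x ∷ y ∷ ys) ≡ reverse ys ++ y ∷ x ∷ []
  reverse-∷∷ = trans (List.unfold-reverse x (y ∷ ys))
                     (trans (cong (_∷ʳ x) (List.unfold-reverse y ys))
                            (List.++-assoc (reverse ys) (y ∷ []) (x ∷ [])))
  direction-xy : not c ≡ iterate not b (3 + k)
  direction-xy = trans (cong (λ j → not (iterate not b j)) (List.length-reverse ys))
                       (trans (sym (iterate-not-suc b k))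
                              (cong (λ d → iterate not d (suc k)) (sym (not-involutive b))))
  direction-y : iterate not b (2 + k) ≡ not (iterate not b (3 + k))
  direction-y = sym (trans (cong not (iterate-not-suc b (2 + k))) (not-involutive _))

∣i∣≡∣j∣⇒i≡j⊎i≡-j : ∀ i j → ∣ i ∣ ≡ ∣ j ∣ → i ≡ j ⊎ i ≡ - j
∣i∣≡∣j∣⇒i≡j⊎i≡-j (+ a)    (+ b)    e = inj₁ (cong +_ e)
∣i∣≡∣j∣⇒i≡j⊎i≡-j (+ a)    -[1+ b ] e = inj₂ (cong +_ e)
∣i∣≡∣j∣⇒i≡j⊎i≡-j -[1+ a ] (+ b)    e = inj₂ (cong (λ k → - (+ k)) e)
∣i∣≡∣j∣⇒i≡j⊎i≡-j -[1+ a ] -[1+ b ] e = inj₁ (cong -[1+_] (suc-injective e))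

i≢-i : ∀ {i} → 1 ≤ ∣ i ∣ → i ≢ - i
i≢-i {+ suc _}   _ ()
i≢-i { -[1+ _ ]} _ ()

Unique-∣∣⇔ : ∀ {q} → All (λ x → 1 ≤ ∣ x ∣) q → Unique (map ∣_∣ q) ⇔ Unique (q ++ map -_ q)
Unique-∣∣⇔ {q} nonzero = mk⇔ to′ from′
  where
  to′ : Unique (map ∣_∣ q) → Unique (q ++ map -_ q)
  to′ u = Unique.++⁺ (Unique.map⁻ u) (Unique.map⁺ ℤ.neg-injective (Unique.map⁻ u)) disjoint
    where
    disjoint : Disjoint q (map -_ q)
    disjoint (x∈q , x∈-q) with ∈-map⁻ -_ x∈-q
    ... | y , y∈q , refl =
      i≢-i (All.lookup nonzero y∈q) (sym (Unique-map⇒injective u x∈q y∈q (ℤ.∣-i∣≡∣i∣ y)))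
  from′ : Unique (q ++ map -_ q) → Unique (map ∣_∣ q)
  from′ u with Unique-++⁻ q u
  ... | uq , _ , disjoint = Unique-map⁺-local injective uq
    where
    injective : ∀ {x y} → x ∈ q → y ∈ q → ∣ x ∣ ≡ ∣ y ∣ → x ≡ y
    injective {x} {y} x∈q y∈q e with ∣i∣≡∣j∣⇒i≡j⊎i≡-j x y e
    ... | inj₁ x≡y  = x≡y
    ... | inj₂ x≡-y = ⊥-elim (disjoint (x∈q , subst (_∈ map -_ q) (sym x≡-y) (∈-map⁺ -_ y∈q)))

neg-antitone : ∀ x y → ((- x) <ℤ? (- y)) ≡ (y <ℤ? x)
neg-antitone x y = ⌊⌋-⇔ (- x ℤ.<? - y) (y ℤ.<? x) (mk⇔ ℤ.neg-cancel-< ℤ.neg-mono-<)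

-x<x≡0<x : ∀ x → ((- x) <ℤ? x) ≡ ((+ 0) <ℤ? x)
-x<x≡0<x (+ zero)  = refl
-x<x≡0<x (+ suc k) = ⌊⌋-⇔ (-[1+ k ] ℤ.<? + suc k) (+ 0 ℤ.<? + suc k)
                       (mk⇔ (λ _ → +<+ (s≤s z≤n)) (λ _ → -<+))
-x<x≡0<x -[1+ k ]  = ⌊⌋-⇔ (+ suc k ℤ.<? -[1+ k ]) (+ 0 ℤ.<? -[1+ k ])
                       (mk⇔ (λ ()) (λ ()))

neg-∈ : ∀ {n x} → ∣ x ∣ ∈[1, n ] → ∣ - x ∣ ∈[1, n ]
neg-∈ {n} {x} = subst (_∈[1, n ]) (sym (ℤ.∣-i∣≡∣i∣ x))

-- The order isomorphism ±[n] ≅ [2n]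

rank : ℕ → ℤ → ℕ
rank n (+ k)    = n + k
rank n -[1+ k ] = n ∸ k

unrank : ℕ → ℕ → ℤ
unrank n b with n ℕ.<? b
... | yes _ = + (b ∸ n)
... | no  _ = -[1+ n ∸ b ]

compl : ℕ → ℕ → ℕ
compl n b = suc (2 * n) ∸ b

rank-∈ : ∀ {n x} → ∣ x ∣ ∈[1, n ] → rank n x ∈[1, 2 * n ]
rank-∈ {n} {+ suc k}   (_ , k<n) =
  ≤-trans (s≤s z≤n) (m≤n+m (suc k) n) , +-monoʳ-≤ n (≤-trans k<n (m≤m+n n 0))
rank-∈ {n} { -[1+ k ]} (_ , k<n) =
  m<n⇒0<n∸m k<n , ≤-trans (m∸n≤m n k) (m≤m+n n _)

unrank-∈ : ∀ {n b} → b ∈[1, 2 * n ] → ∣ unrank n b ∣ ∈[1, n ]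
unrank-∈ {n} {b} (1≤b , b≤2n) with n ℕ.<? b
... | yes n<b = m<n⇒0<n∸m n<b , ≤-trans (m≤n+o⇒m∸n≤o b n b≤2n) (≤-reflexive (+-identityʳ n))
... | no  n≮b = s≤s z≤n , ∸-monoʳ-< 1≤b (≮⇒≥ n≮b)

unrank-rank : ∀ {n x} → ∣ x ∣ ∈[1, n ] → unrank n (rank n x) ≡ x
unrank-rank {n} {+ suc k} _ with n ℕ.<? n + suc k
... | yes _  = cong +_ (m+n∸m≡n n (suc k))
... | no  n≮ = ⊥-elim (n≮ (m<m+n n (s≤s z≤n)))
unrank-rank {n} { -[1+ k ]} (_ , k<n) with n ℕ.<? n ∸ k
... | yes n< = ⊥-elim (<⇒≱ n< (m∸n≤m n k))
... | no  _  = cong -[1+_] (m∸[m∸n]≡n (<⇒≤ k<n))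

rank-unrank : ∀ n b → rank n (unrank n b) ≡ b
rank-unrank n b with n ℕ.<? b
... | yes n<b = m+[n∸m]≡n (<⇒≤ n<b)
... | no  n≮b = m∸[m∸n]≡n (≮⇒≥ n≮b)

rank-monotone : ∀ {n x y} → ∣ x ∣ ∈[1, n ] → ∣ y ∣ ∈[1, n ] → (rank n x <ℕ? rank n y) ≡ (x <ℤ? y)
rank-monotone {n} {+ suc a} {+ suc b} _ _ = ⌊⌋-⇔ (n + suc a ℕ.<? n + suc b) (+ suc a ℤ.<? + suc b)
  (mk⇔ (λ h → +<+ (+-cancelˡ-< n _ _ h)) (λ where (+<+ h) → +-monoʳ-< n h))
rank-monotone {n} { -[1+ a ]} { -[1+ b ]} (_ , a<n) _ = ⌊⌋-⇔ (n ∸ a ℕ.<? n ∸ b) (-[1+ a ] ℤ.<? -[1+ b ])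
  (mk⇔ (λ h → -<- (∸-cancelʳ-< h)) (λ where (-<- h) → ∸-monoʳ-< h (<⇒≤ a<n)))
rank-monotone {n} { -[1+ a ]} {+ suc b} _ _ = ⌊⌋-⇔ (n ∸ a ℕ.<? n + suc b) (-[1+ a ] ℤ.<? + suc b)
  (mk⇔ (λ _ → -<+) (λ _ → ≤-<-trans (m∸n≤m n a) (m<m+n n (s≤s z≤n))))
rank-monotone {n} {+ suc a} { -[1+ b ]} _ _ = ⌊⌋-⇔ (n + suc a ℕ.<? n ∸ b) (+ suc a ℤ.<? -[1+ b ])
  (mk⇔ (λ h → ⊥-elim (<⇒≱ h (≤-trans (m∸n≤m n b) (m≤m+n n _)))) (λ ()))

compl-∈ : ∀ {n b} → b ∈[1, 2 * n ] → compl n b ∈[1, 2 * n ]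
compl-∈ {n} (1≤b , b≤2n) = m<n⇒0<n∸m (s≤s b≤2n) , ∸-monoʳ-≤ (suc (2 * n)) 1≤b

compl-involutive : ∀ {n b} → b ≤ suc (2 * n) → compl n (compl n b) ≡ b
compl-involutive = m∸[m∸n]≡n

compl-antitone : ∀ {n b b′} → b ∈[1, 2 * n ] → b′ ∈[1, 2 * n ] →
                 (compl n b <ℕ? compl n b′) ≡ (b′ <ℕ? b)
compl-antitone {n} {b} {b′} (_ , b≤2n) _ = ⌊⌋-⇔ (compl n b ℕ.<? compl n b′) (b′ ℕ.<? b)
  (mk⇔ ∸-cancelʳ-< (λ b′<b → ∸-monoʳ-< b′<b (m≤n⇒m≤1+n b≤2n)))

rank-neg : ∀ {n x} → ∣ x ∣ ∈[1, n ] → rank n (- x) ≡ compl n (rank n x)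
rank-neg {n} {+ suc k} _ = sym (begin
  suc (n + (n + 0)) ∸ (n + suc k) ≡⟨ cong (suc (n + (n + 0)) ∸_) (+-suc n k) ⟩
  (n + (n + 0)) ∸ (n + k)         ≡⟨ [m+n]∸[m+o]≡n∸o n (n + 0) k ⟩
  (n + 0) ∸ k                     ≡⟨ cong (_∸ k) (+-identityʳ n) ⟩
  n ∸ k                           ∎)
  where open ≡-Reasoning
rank-neg {n} { -[1+ k ]} (_ , k<n) = begin
  rank n (+ suc k)
    ≡⟨ compl-involutive {n} (m≤n⇒m≤1+n (proj₂ (rank-∈ {n} {+ suc k} k∈))) ⟨
  compl n (compl n (rank n (+ suc k)))
    ≡⟨ cong (compl n) (rank-neg {x = + suc k} k∈) ⟨
  compl n (rank n -[1+ k ]) ∎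
  where
  open ≡-Reasoning
  k∈ = s≤s z≤n , k<n

-- Snakes and right halves

isEven : ℕ → Bool
isEven = iterate not true

negateUnless : Bool → ℤ → ℤ
negateUnless true  = id
negateUnless false = -_

negateUnless-∈ : ∀ b {n x} → ∣ x ∣ ∈[1, n ] → ∣ negateUnless b x ∣ ∈[1, n ]
negateUnless-∈ true  = id
negateUnless-∈ false {x = x} = neg-∈ {x = x}

negateUnless-involutive : ∀ b x → negateUnless b (negateUnless b x) ≡ x
negateUnless-involutive true  x = refl
negateUnless-involutive false x = ℤ.neg-involutive x

negateUnless-neg : ∀ b x → negateUnless b (- x) ≡ - negateUnless b x
negateUnless-neg true  x = refl
negateUnless-neg false x = refl

encode : ℕ → ℤ → ℕ
encode n = rank n ∘ negateUnless (isEven n)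

decode : ℕ → ℕ → ℤ
decode n = negateUnless (isEven n) ∘ unrank n

encode-∈ : ∀ {n x} → ∣ x ∣ ∈[1, n ] → encode n x ∈[1, 2 * n ]
encode-∈ {n} {x} x∈ = rank-∈ {x = negateUnless (isEven n) x} (negateUnless-∈ (isEven n) x∈)

decode-∈ : ∀ {n b} → b ∈[1, 2 * n ] → ∣ decode n b ∣ ∈[1, n ]
decode-∈ {n} = negateUnless-∈ (isEven n) ∘ unrank-∈

decode-encode : ∀ {n x} → ∣ x ∣ ∈[1, n ] → decode n (encode n x) ≡ x
decode-encode {n} {x} x∈ =
  trans (cong (negateUnless d) (unrank-rank {x = negateUnless d x} (negateUnless-∈ d x∈)))
        (negateUnless-involutive d x)
  where d = isEven n

encode-decode : ∀ n b → encode n (decode n b) ≡ b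
encode-decode n b = trans (cong (rank n) (negateUnless-involutive (isEven n) (unrank n b))) (rank-unrank n b)

encode-neg : ∀ {n x} → ∣ x ∣ ∈[1, n ] → encode n (- x) ≡ compl n (encode n x)
encode-neg {n} {x} x∈ =
  trans (cong (rank n) (negateUnless-neg d x)) (rank-neg {x = negateUnless d x} (negateUnless-∈ d x∈))
  where d = isEven n

map-encode-decode : ∀ n B → map (encode n) (map (decode n) B) ≡ B
map-encode-decode n B = trans (sym (List.map-∘ B)) (trans (List.map-cong (encode-decode n) B) (List.map-id B))

map-decode-encode : ∀ {n q} → All (λ x → ∣ x ∣ ∈[1, n ]) q → map (decode n) (map (encode n) q) ≡ q
map-decode-encode {q = q} q∈ = trans (sym (List.map-∘ q)) (List.map-id-local (All.map decode-encode q∈))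

Alt-negateUnless : ∀ b q → Alt _<ℤ?_ b (map (negateUnless b) q) ≡ Alt _<ℤ?_ true q
Alt-negateUnless true  q = cong (Alt _<ℤ?_ true) (List.map-id q)
Alt-negateUnless false q =
  trans (Alt-map {P = λ _ → ⊤} (λ {x} {y} _ _ → neg-antitone x y) false (All.universal _ q))
        (Alt-flip _<ℤ?_ false q)

Alt-encode : ∀ {n q} → All (λ x → ∣ x ∣ ∈[1, n ]) q →
             Alt _<ℕ?_ (isEven n) (map (encode n) q) ≡ Alt _<ℤ?_ true q
Alt-encode {n} {q} q∈ = begin
  Alt _<ℕ?_ d (map (rank n ∘ negateUnless d) q)
    ≡⟨ cong (Alt _<ℕ?_ d) (List.map-∘ q) ⟩
  Alt _<ℕ?_ d (map (rank n) (map (negateUnless d) q))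
    ≡⟨ Alt-map rank-monotone d (AllP.map⁺ (All.map (negateUnless-∈ d) q∈)) ⟩
  Alt _<ℤ?_ d (map (negateUnless d) q)
    ≡⟨ Alt-negateUnless d q ⟩
  Alt _<ℤ?_ true q ∎
  where
  open ≡-Reasoning
  d = isEven n

onHead : (A → Bool) → List A → Bool
onHead p []      = true
onHead p (x ∷ _) = p x

-- The comparison between πₙ = compl n b and πₙ₊₁ = b, where the two halves of a mirror meet.
junction : ℕ → List ℕ → Bool
junction n = onHead (λ b → step _<ℕ?_ (isEven n) b (compl n b))

step-negateUnless : ∀ b x → step _<ℤ?_ b (negateUnless b x) (negateUnless b (- x)) ≡ ((- x) <ℤ? x)
step-negateUnless true  x = refl
step-negateUnless false x = cong ((- x) <ℤ?_) (ℤ.neg-involutive x)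

junction-encode : ∀ {n q} → All (λ x → ∣ x ∣ ∈[1, n ]) q →
                  junction n (map (encode n) q) ≡ onHead ((+ 0) <ℤ?_) q
junction-encode                []       = refl
junction-encode {n} {x ∷ _} (x∈ ∷ _) = begin
  step _<ℕ?_ d (encode n x) (compl n (encode n x))
    ≡⟨ cong (step _<ℕ?_ d (encode n x)) (encode-neg x∈) ⟨
  step _<ℕ?_ d (rank n (negateUnless d x)) (rank n (negateUnless d (- x)))
    ≡⟨ step-map {f = rank n} d (rank-monotone εx∈ ε-x∈) (rank-monotone ε-x∈ εx∈) ⟩
  step _<ℤ?_ d (negateUnless d x) (negateUnless d (- x))
    ≡⟨ step-negateUnless d x ⟩
  ((- x) <ℤ? x)
    ≡⟨ -x<x≡0<x x ⟩
  ((+ 0) <ℤ? x) ∎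
  where
  open ≡-Reasoning
  d = isEven n
  εx∈ = negateUnless-∈ d x∈
  ε-x∈ = negateUnless-∈ d (neg-∈ {x = x} x∈)

Unique-encode⇔ : ∀ {n q} → All (λ x → ∣ x ∣ ∈[1, n ]) q →
                 Unique (map ∣_∣ q) ⇔ Unique (map (encode n) q ++ map (compl n) (map (encode n) q))
Unique-encode⇔ {n} {q} q∈ =
  subst (λ l → Unique (map ∣_∣ q) ⇔ Unique l) encode-++
    (⇔-trans (Unique-∣∣⇔ (All.map proj₁ q∈)) (⇔-sym (Unique-map⇔ encode-injective)))
  where
  ±q∈ : All (λ x → ∣ x ∣ ∈[1, n ]) (q ++ map -_ q)
  ±q∈ = AllP.++⁺ q∈ (AllP.map⁺ (All.map (λ {x} → neg-∈ {x = x}) q∈))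
  encode-injective : ∀ {x y} → x ∈ q ++ map -_ q → y ∈ q ++ map -_ q → encode n x ≡ encode n y → x ≡ y
  encode-injective x∈ y∈ e =
    trans (sym (decode-encode (All.lookup ±q∈ x∈)))
          (trans (cong (decode n) e) (decode-encode (All.lookup ±q∈ y∈)))
  encode-++ : map (encode n) (q ++ map -_ q) ≡ map (encode n) q ++ map (compl n) (map (encode n) q)
  encode-++ = trans (List.map-++ (encode n) q (map -_ q))
    (cong (map (encode n) q ++_)
          (trans (sym (List.map-∘ q)) (trans (List.map-cong-local (All.map encode-neg q∈)) (List.map-∘ q))))

record IsSnake (n : ℕ) (q : List ℤ) : Set where
  field
    bounded      : All (λ x → ∣ x ∣ ∈[1, n ]) q
    uniqueAbs    : Unique (map ∣_∣ q)
    headPositive : T (onHead ((+ 0) <ℤ?_) q)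
    alternating  : T (Alt _<ℤ?_ true q)

record RightHalf (n : ℕ) (B : List ℕ) : Set where
  field
    bounded     : All (_∈[1, 2 * n ]) B
    unique      : Unique (B ++ map (compl n) B)
    junctionOK  : T (junction n B)
    alternating : T (Alt _<ℕ?_ (isEven n) B)

snake⇔rightHalf : ∀ {n q} → All (λ x → ∣ x ∣ ∈[1, n ]) q → IsSnake n q ⇔ RightHalf n (map (encode n) q)
snake⇔rightHalf {n} {q} q∈ = mk⇔ to′ from′
  where
  to′ : IsSnake n q → RightHalf n (map (encode n) q)
  to′ s = record
    { bounded     = AllP.map⁺ (All.map encode-∈ q∈)
    ; unique      = to (Unique-encode⇔ q∈) uniqueAbs
    ; junctionOK  = subst T (sym (junction-encode q∈)) headPositive
    ; alternating = subst T (sym (Alt-encode q∈)) alternating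
    }
    where open IsSnake s
  from′ : RightHalf n (map (encode n) q) → IsSnake n q
  from′ h = record
    { bounded      = q∈
    ; uniqueAbs    = from (Unique-encode⇔ q∈) unique
    ; headPositive = subst T (junction-encode q∈) junctionOK
    ; alternating  = subst T (Alt-encode q∈) alternating
    }
    where open RightHalf h

rightHalf⇒snake : ∀ {n B} → RightHalf n B → IsSnake n (map (decode n) B)
rightHalf⇒snake {n} {B} h = from (snake⇔rightHalf (AllP.map⁺ (All.map decode-∈ (RightHalf.bounded h))))
                                 (subst (RightHalf n) (sym (map-encode-decode n B)) h)

-- Rc-invariant words as mirrors

mirror : ℕ → List ℕ → List ℕ
mirror n B = reverse (map (compl n) B) ++ B

record IsRCAlt (n : ℕ) (π : List ℕ) : Set where
  field
    bounded     : All (_∈[1, 2 * n ]) π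
    unique      : Unique π
    alternating : T (Alt _<ℕ?_ true π)
    rcInvariant : π ≡ map (compl n) (reverse π)

rcInvariant⇒mirror : ∀ {f : A → A} {L R} → length L ≡ length R → L ++ R ≡ map f (reverse (L ++ R)) →
                     L ≡ reverse (map f R)
rcInvariant⇒mirror {f = f} {L} {R} len rc =
  trans (proj₁ (++-injective len′ (trans rc halves))) (List.reverse-map f R)
  where
  halves : map f (reverse (L ++ R)) ≡ map f (reverse R) ++ map f (reverse L)
  halves = trans (cong (map f) (List.reverse-++ L R)) (List.map-++ f (reverse R) (reverse L))
  len′ : length L ≡ length (map f (reverse R))
  len′ = trans len (sym (trans (List.length-map f (reverse R)) (List.length-reverse R)))

mirror↭ : ∀ n B → mirror n B ↭ B ++ map (compl n) B
mirror↭ n B = ↭-trans (↭.++⁺ʳ B (↭.↭-reverse (map (compl n) B))) (↭.++-comm (map (compl n) B) B)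

mirror-rcInvariant : ∀ {n B} → All (_∈[1, 2 * n ]) B → mirror n B ≡ map (compl n) (reverse (mirror n B))
mirror-rcInvariant {n} {B} B∈ = sym (begin
  map c (reverse (reverse (map c B) ++ B))         ≡⟨ cong (map c) (List.reverse-++ (reverse (map c B)) B) ⟩
  map c (reverse B ++ reverse (reverse (map c B))) ≡⟨ cong (λ l → map c (reverse B ++ l))
                                                          (List.reverse-involutive (map c B)) ⟩
  map c (reverse B ++ map c B)                     ≡⟨ List.map-++ c (reverse B) (map c B) ⟩
  map c (reverse B) ++ map c (map c B)             ≡⟨ cong₂ _++_ (List.reverse-map c B) compl-compl ⟩
  reverse (map c B) ++ B                           ∎)
  where
  open ≡-Reasoning
  c = compl n
  compl-compl : map c (map c B) ≡ B
  compl-compl = trans (sym (List.map-∘ B))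
                      (List.map-id-local (All.map (compl-involutive {n} ∘ m≤n⇒m≤1+n ∘ proj₂) B∈))

Alt-compl : ∀ {n} b {B} → All (_∈[1, 2 * n ]) B → Alt _<ℕ?_ (not b) (map (compl n) B) ≡ Alt _<ℕ?_ b B
Alt-compl {n} b {B} B∈ = begin
  Alt _<ℕ?_ (not b) (map (compl n) B) ≡⟨ Alt-map (compl-antitone {n}) (not b) B∈ ⟩
  Alt (flip _<ℕ?_) (not b) B          ≡⟨ Alt-flip _<ℕ?_ (not b) B ⟩
  Alt _<ℕ?_ (not (not b)) B           ≡⟨ cong (λ c → Alt _<ℕ?_ c B) (not-involutive b) ⟩
  Alt _<ℕ?_ b B                       ∎
  where open ≡-Reasoning

Alt-mirror : ∀ {n B} → length B ≡ n → All (_∈[1, 2 * n ]) B →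
             Alt _<ℕ?_ true (mirror n B) ≡ junction n B ∧ Alt _<ℕ?_ (isEven n) B
Alt-mirror {B = []} _ _ = refl
Alt-mirror {n} {B@(b ∷ B′)} len B∈ = begin
  Alt _<ℕ?_ true (reverse cB ++ b ∷ B′)
    ≡⟨ Alt-++ _<ℕ?_ true (reverse cB) b B′ ⟩
  Alt _<ℕ?_ true (reverse cB ∷ʳ b) ∧ Alt _<ℕ?_ (isEven (length (reverse cB))) B
    ≡⟨ cong₂ _∧_ (cong (Alt _<ℕ?_ true) (sym (List.unfold-reverse b cB)))
                 (cong (λ k → Alt _<ℕ?_ (isEven k) B) (trans (List.length-reverse cB) length-cB)) ⟩
  Alt _<ℕ?_ true (reverse (b ∷ cB)) ∧ Alt _<ℕ?_ d B
    ≡⟨ cong (_∧ Alt _<ℕ?_ d B) (Alt-reverse _<ℕ?_ true (b ∷ cB)) ⟩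
  Alt _<ℕ?_ (isEven (length cB)) (b ∷ cB) ∧ Alt _<ℕ?_ d B
    ≡⟨ cong (λ k → Alt _<ℕ?_ (isEven k) (b ∷ cB) ∧ Alt _<ℕ?_ d B) length-cB ⟩
  (step _<ℕ?_ d b (compl n b) ∧ Alt _<ℕ?_ (not d) cB) ∧ Alt _<ℕ?_ d B
    ≡⟨ cong (λ a → (step _<ℕ?_ d b (compl n b) ∧ a) ∧ Alt _<ℕ?_ d B) (Alt-compl {n} d B∈) ⟩
  (step _<ℕ?_ d b (compl n b) ∧ Alt _<ℕ?_ d B) ∧ Alt _<ℕ?_ d B
    ≡⟨ ∧-assoc (step _<ℕ?_ d b (compl n b)) _ _ ⟩
  step _<ℕ?_ d b (compl n b) ∧ (Alt _<ℕ?_ d B ∧ Alt _<ℕ?_ d B)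
    ≡⟨ cong (step _<ℕ?_ d b (compl n b) ∧_) (∧-idem _) ⟩
  step _<ℕ?_ d b (compl n b) ∧ Alt _<ℕ?_ d B ∎
  where
  open ≡-Reasoning
  d = isEven n
  cB = map (compl n) B
  length-cB : length cB ≡ n
  length-cB = trans (List.length-map (compl n) B) len

mirror-isRCAlt⇔ : ∀ {n B} → length B ≡ n → IsRCAlt n (mirror n B) ⇔ RightHalf n B
mirror-isRCAlt⇔ {n} {B} len = mk⇔ to′ from′
  where
  to′ : IsRCAlt n (mirror n B) → RightHalf n B
  to′ π = record
    { bounded     = B∈
    ; unique      = ↭.Unique-resp-↭ (mirror↭ n B) unique
    ; junctionOK  = proj₁ junction×alternating
    ; alternating = proj₂ junction×alternating
    }
    where
    open IsRCAlt π
    B∈ = AllP.++⁻ʳ (reverse (map (compl n) B)) bounded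
    junction×alternating = to T-∧ (subst T (Alt-mirror len B∈) alternating)
  from′ : RightHalf n B → IsRCAlt n (mirror n B)
  from′ h = record
    { bounded     = ↭.All-resp-↭ (subst (_∈[1, 2 * n ])) (↭-sym (mirror↭ n B))
                                 (AllP.++⁺ bounded (AllP.map⁺ (All.map (compl-∈ {n}) bounded)))
    ; unique      = ↭.Unique-resp-↭ (↭-sym (mirror↭ n B)) unique
    ; alternating = subst T (sym (Alt-mirror len bounded)) (from T-∧ (junctionOK , alternating))
    ; rcInvariant = mirror-rcInvariant {n} bounded
    }
    where open RightHalf h

headPos≡onHead : ∀ {n} (p : Vec ℤ n) → headPos p ≡ onHead ((+ 0) <ℤ?_) (toList p)
headPos≡onHead V.[]      = refl
headPos≡onHead (_ V.∷ _) = refl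

T-isPerm : ∀ k xs → T (inRange k xs ∧ distinct xs) ⇔ (All (_∈[1, k ]) xs × Unique xs)
T-isPerm k xs = ⇔-trans T-∧ (T-inRange k xs ×-⇔ T-distinct xs)

T-isSnake : ∀ {n} (p : Vec ℤ n) → T (isSnake n p) ⇔ IsSnake n (toList p)
T-isSnake {n} p = mk⇔ to′ from′
  where
  q = toList p
  ∣q∣ = map ∣_∣ q
  signedPerm⇔ : T (isSignedPerm n p) ⇔ (All (_∈[1, n ]) ∣q∣ × Unique ∣q∣)
  signedPerm⇔ = subst (λ l → T (inRange n l ∧ distinct l) ⇔ (All (_∈[1, n ]) ∣q∣ × Unique ∣q∣))
                      (sym (VP.toList-map ∣_∣ p)) (T-isPerm n ∣q∣)
  to′ : T (isSnake n p) → IsSnake n q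
  to′ t = let perm , h×a = to T-∧ t
              b , u      = to signedPerm⇔ perm
              h , a      = to T-∧ h×a
          in record { bounded      = AllP.map⁻ b
                    ; uniqueAbs    = u
                    ; headPositive = subst T (headPos≡onHead p) h
                    ; alternating  = subst T (altDown≡Alt _<ℤ?_ q) a
                    }
  from′ : IsSnake n q → T (isSnake n p)
  from′ s = from T-∧ (from signedPerm⇔ (AllP.map⁺ bounded , uniqueAbs) ,
                      from T-∧ (subst T (sym (headPos≡onHead p)) headPositive ,
                                subst T (sym (altDown≡Alt _<ℤ?_ q)) alternating))
    where open IsSnake s

sumsTo : ℕ → List ℕ → List ℕ → Bool
sumsTo K xs ys = all (λ b → b) (zipWith (λ a b → ⌊ a + b ℕ.≟ K ⌋) xs ys)

T-sumsTo : ∀ K xs ys → length xs ≡ length ys → All (_≤ K) ys → T (sumsTo K xs ys) ⇔ xs ≡ map (K ∸_) ys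
T-sumsTo K []       []       _   _            = mk⇔ (λ _ → refl) (λ _ → tt)
T-sumsTo K (x ∷ xs) (y ∷ ys) len (y≤K ∷ ys≤K) = mk⇔
  (λ t → let e , es = to T-∧ t in cong₂ _∷_ (x≡K∸y (toWitness {a? = x + y ℕ.≟ K} e)) (to rest es))
  (λ eq → from T-∧ (fromWitness (trans (cong (_+ y) (List.∷-injectiveˡ eq)) (m∸n+n≡m y≤K)) ,
                    from rest (List.∷-injectiveʳ eq)))
  where
  rest = T-sumsTo K xs ys (suc-injective len) ys≤K
  x≡K∸y : x + y ≡ K → x ≡ K ∸ y
  x≡K∸y e = trans (sym (m+n∸n≡m x y)) (cong (_∸ y) e)

T-isRCAlt : ∀ {n} (π : Vec ℕ (2 * n)) → T (isRCAlt n π) ⇔ IsRCAlt n (toList π)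
T-isRCAlt {n} π = mk⇔ to′ from′
  where
  l = toList π
  K = suc (2 * n)
  rc⇔ : All (_∈[1, 2 * n ]) l → T (isRC n π) ⇔ l ≡ map (compl n) (reverse l)
  rc⇔ l∈ = subst (λ l′ → T (sumsTo K l l′) ⇔ l ≡ map (compl n) (reverse l)) (sym (VP.toList-reverse π))
                 (T-sumsTo K l (reverse l) (sym (List.length-reverse l)) reverse-l≤K)
    where
    reverse-l≤K : All (_≤ K) (reverse l)
    reverse-l≤K = ↭.All-resp-↭ (subst (_≤ K)) (↭-sym (↭.↭-reverse l)) (All.map (m≤n⇒m≤1+n ∘ proj₂) l∈)
  to′ : T (isRCAlt n π) → IsRCAlt n l
  to′ t = let perm , a×rc = to T-∧ t
              b , u       = to (T-isPerm (2 * n) l) perm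
              a , rc      = to T-∧ a×rc
          in record { bounded     = b
                    ; unique      = u
                    ; alternating = subst T (altDown≡Alt _<ℕ?_ l) a
                    ; rcInvariant = to (rc⇔ b) rc
                    }
  from′ : IsRCAlt n l → T (isRCAlt n π)
  from′ r = from T-∧ (from (T-isPerm (2 * n) l) (bounded , unique) ,
                      from T-∧ (subst T (sym (altDown≡Alt _<ℕ?_ l)) alternating ,
                                from (rc⇔ bounded) rcInvariant))
    where open IsRCAlt r

toList-injective : ∀ {n} (xs ys : Vec A n) → toList xs ≡ toList ys → xs ≡ ys
toList-injective xs ys e = trans (sym (VP.cast-is-id refl xs)) (VP.toList-injective refl xs ys e)

-- 2 * n unfolds to n + (n + 0), whence the casts.
secondHalf : ∀ n → Vec A (2 * n) → Vec A n
secondHalf n π = V.cast (+-identityʳ n) (V.drop n π)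

toList-halves : ∀ n (π : Vec A (2 * n)) → toList π ≡ toList (V.take n π) ++ toList (secondHalf n π)
toList-halves n π = begin
  toList π                                       ≡⟨ cong toList (VP.take++drop≡id n π) ⟨
  toList (V.take n π V.++ V.drop n π)            ≡⟨ VP.toList-++ (V.take n π) (V.drop n π) ⟩
  toList (V.take n π) ++ toList (V.drop n π)     ≡⟨ cong (toList (V.take n π) ++_)
                                                         (VP.toList-cast (+-identityʳ n) (V.drop n π)) ⟨
  toList (V.take n π) ++ toList (secondHalf n π) ∎
  where open ≡-Reasoning

rcAlt≡mirror : ∀ n (π : Vec ℕ (2 * n)) → IsRCAlt n (toList π) →
               toList π ≡ mirror n (toList (secondHalf n π))
rcAlt≡mirror n π r = trans halves (cong (_++ toList (secondHalf n π)) (rcInvariant⇒mirror equal-lengths rc))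
  where
  halves = toList-halves n π
  equal-lengths : length (toList (V.take n π)) ≡ length (toList (secondHalf n π))
  equal-lengths = trans (VP.length-toList (V.take n π)) (sym (VP.length-toList (secondHalf n π)))
  rc = subst (λ l → l ≡ map (compl n) (reverse l)) halves (IsRCAlt.rcInvariant r)

toRCAlt : ∀ n → Vec ℤ n → Vec ℕ (2 * n)
toRCAlt n p = V.reverse (V.map (compl n) B) V.++ V.cast (sym (+-identityʳ n)) B
  where B = V.map (encode n) p

toSnake : ∀ n → Vec ℕ (2 * n) → Vec ℤ n
toSnake n π = V.map (decode n) (secondHalf n π)

toList-toRCAlt : ∀ n (p : Vec ℤ n) → toList (toRCAlt n p) ≡ mirror n (map (encode n) (toList p))
toList-toRCAlt n p = trans (VP.toList-++ (V.reverse (V.map (compl n) B)) _)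
  (cong₂ _++_ (trans (VP.toList-reverse (V.map (compl n) B))
                     (cong reverse (trans (VP.toList-map (compl n) B) (cong (map (compl n)) toList-B))))
              (trans (VP.toList-cast _ B) toList-B))
  where
  B = V.map (encode n) p
  toList-B = VP.toList-map (encode n) p

module _ (n : ℕ) where

  toRCAlt-closed : ∀ p → T (isSnake n p) → T (isRCAlt n (toRCAlt n p))
  toRCAlt-closed p t = from (T-isRCAlt (toRCAlt n p)) (subst (IsRCAlt n) (sym (toList-toRCAlt n p))
    (from (mirror-isRCAlt⇔ (trans (List.length-map (encode n) (toList p)) (VP.length-toList p)))
          (to (snake⇔rightHalf (IsSnake.bounded s)) s)))
    where s = to (T-isSnake p) t

  rightHalf : ∀ π → T (isRCAlt n π) → RightHalf n (toList (secondHalf n π))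
  rightHalf π t = to (mirror-isRCAlt⇔ (VP.length-toList (secondHalf n π)))
                     (subst (IsRCAlt n) (rcAlt≡mirror n π r) r)
    where r = to (T-isRCAlt π) t

  toSnake-closed : ∀ π → T (isRCAlt n π) → T (isSnake n (toSnake n π))
  toSnake-closed π t = from (T-isSnake (toSnake n π))
    (subst (IsSnake n) (sym (VP.toList-map (decode n) (secondHalf n π))) (rightHalf⇒snake (rightHalf π t)))

  toRCAlt-toSnake : ∀ π → T (isRCAlt n π) → toRCAlt n (toSnake n π) ≡ π
  toRCAlt-toSnake π t = toList-injective _ _ (begin
    toList (toRCAlt n (toSnake n π))                 ≡⟨ toList-toRCAlt n (toSnake n π) ⟩
    mirror n (map (encode n) (toList (toSnake n π))) ≡⟨ cong (mirror n ∘ map (encode n))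
                                                             (VP.toList-map (decode n) (secondHalf n π)) ⟩
    mirror n (map (encode n) (map (decode n) B))     ≡⟨ cong (mirror n) (map-encode-decode n B) ⟩
    mirror n B                                       ≡⟨ rcAlt≡mirror n π (to (T-isRCAlt π) t) ⟨
    toList π                                         ∎)
    where
    open ≡-Reasoning
    B = toList (secondHalf n π)

  toSnake-toRCAlt : ∀ p → T (isSnake n p) → toSnake n (toRCAlt n p) ≡ p
  toSnake-toRCAlt p t = toList-injective _ _ (begin
    toList (toSnake n π)                     ≡⟨ VP.toList-map (decode n) (secondHalf n π) ⟩
    map (decode n) (toList (secondHalf n π)) ≡⟨ cong (map (decode n)) secondHalf≡B ⟩
    map (decode n) (map (encode n) q)        ≡⟨ map-decode-encode (IsSnake.bounded (to (T-isSnake p) t)) ⟩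
    q                                        ∎)
    where
    open ≡-Reasoning
    q = toList p
    π = toRCAlt n p
    B = map (encode n) q
    length-B : length B ≡ n
    length-B = trans (List.length-map (encode n) q) (VP.length-toList p)
    equal-lengths : length (toList (V.take n π)) ≡ length (reverse (map (compl n) B))
    equal-lengths = trans (VP.length-toList (V.take n π))
      (sym (trans (List.length-reverse (map (compl n) B)) (trans (List.length-map (compl n) B) length-B)))
    secondHalf≡B : toList (secondHalf n π) ≡ B
    secondHalf≡B = proj₂ (++-injective equal-lengths (trans (sym (toList-halves n π)) (toList-toRCAlt n p)))

snakes⤖rcAlt : ∀ n → Snakes n ⤖ RCAlt n
snakes⤖rcAlt n = restrict-⤖ {P = isSnake n} {Q = isRCAlt n} (toRCAlt n) (toSnake n)
                   (toRCAlt-closed n) (toSnake-closed n) (toRCAlt-toSnake n) (toSnake-toRCAlt n)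

mainTheorem3 : (n : ℕ) → n ≥ 1 → Snakes n ⤖ RCAlt n
mainTheorem3 n _ = snakes⤖rcAlt n
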